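{- Let $B=(G,\mathbf{i},V_+,V_0,V_-,\rho,X)$ be a symmetric labeled bigraph with dual $B^*=(G^*,\mathbf{i}^*,U_+,U_0,U_-,\rho^*,X^*)$. If $G$ and $G^*$ are admissible $ADE$ bigraphs, then $h(G)=h(G^*)$ and $h'(G)=h'(G^*)$.
   Context: A bigraph $G=(\Gamma,\Delta)$ is a pair of simple graphs on a common vertex set sharing no edges; bipartite if some $\epsilon$ properly 2-colors both. An admissible $ADE$ bigraph is a bipartite bigraph with every connected component of $\Gamma$ and of $\Delta$ a Dynkin diagram of type $A_n,D_n,E_6,E_7,E_8$ and $A_\Gamma A_\Delta=A_\Delta A_\Gamma$. Coxeter numbers: $h(A_n)=n+1$, $h(D_m)=2m-2$, $h(E_6)=12$, $h(E_7)=18$, $h(E_8)=30$. For an admissible $ADE$ bigraph $G$, $h(G)$ (resp. $h'(G)$) denotes the common Coxeter number of all connected components of $\Gamma$ (resp. $\Delta$); by a result of Stembridge such common numbers exist for connected admissible $ADE$ bigraphs. A symmetric labeled bigraph $B=(G,\mathbf{i},V_+,V_0,V_-,\rho,X)$: a bipartite bigraph $G$ on $V$; an order-2 automorphism $\mathbf{i}$ of $G$ preserving $\epsilon$, $\Gamma$, $\Delta$; $V_0$ its fixed-point set; a partition $V=V_+\sqcup V_0\sqcup V_-$ with each non-fixed pair $\{v,\mathbf{i}(v)\}$ having one element in each of $V_+,V_-$; $\rho:V\to\mathbb{R}$ with $\rho\circ\mathbf{i}=\rho$; $X$ a set of edges with both endpoints in $V_0$. Write $V_\pm=\{v_1^\pm,\dots,v_k^\pm\}$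 with $\mathbf{i}(v_j^+)=v_j^-$ and $V_0=\{v_{k+1},\dots,v_n\}$. The dual $B^*$ has vertices $U_0=\{u_1,\dots,u_k\}$, $U_\pm=\{u_{k+1}^\pm,\dots,u_n^\pm\}$; $\mathbf{i}^*$ fixes $u_j$ and swaps $u_j^\pm$; $\rho^*(u_j)=\sqrt2\rho(v_j^\pm)$, $\rho^*(u_j^\pm)=\rho(v_j)/\sqrt2$; $\Gamma^*$, $X^*\cap\Gamma^*$ by: $\{v_i,v_j\}\in\Gamma\cap X$ iff $\{u_i^+,u_j^-\},\{u_i^-,u_j^+\}\in\Gamma^*$; $\{v_i,v_j\}\in\Gamma\setminus X$ iff $\{u_i^+,u_j^+\},\{u_i^-,u_j^-\}\in\Gamma^*$; $\{v_i^+,v_j\},\{v_i^-,v_j\}\in\Gamma$ iff $\{u_i^+,u_j\},\{u_i^-,u_j\}\in\Gamma^*$; $\{v_i^+,v_j^+\},\{v_i^-,v_j^-\}\in\Gamma$ iff $\{u_i,u_j\}\in\Gamma^*\setminus X^*$; $\{v_i^+,v_j^-\},\{v_i^-,v_j^+\}\in\Gamma$ iff $\{u_i,u_j\}\in\Gamma^*\cap X^*$; same rules for $\Delta^*$. -}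

module Defs where

open import Data.Bool using (Bool; true; false; _∧_; _∨_; not)
open import Data.Nat using (ℕ; zero; suc; _+_; _*_; _∸_; _≡ᵇ_; _<ᵇ_)
open import Data.Fin using (Fin; toℕ)
open import Data.Product using (Σ; _×_; ∃)
open import Function.Definitions using (Injective)
open import Relation.Binary.PropositionalEquality using (_≡_)
open import Relation.Binary.Construct.Closure.ReflexiveTransitive using (Star)

Graph : Set → Set
Graph V = V → V → Bool

IsBigraph : {V : Set} → Graph V → Graph V → Set
IsBigraph {V} Γ Δ =
  (∀ u v → Γ u v ≡ Γ v u) × (∀ v → Γ v v ≡ false) ×
  (∀ u v → Δ u v ≡ Δ v u) × (∀ v → Δ v v ≡ false) ×
  (∀ u v → Γ u v ≡ true → Δ u v ≡ false)

ProperColouring : {V : Set} → (V → Bool) → Graph V → Set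
ProperColouring {V} ε Γ = ∀ u v → Γ u v ≡ true → ε u ≡ not (ε v)

IsBipartite : {V : Set} → Graph V → Graph V → Set
IsBipartite {V} Γ Δ = Σ (V → Bool) λ ε → ProperColouring ε Γ × ProperColouring ε Δ

-- Dynkin diagrams of type A, D, E.
-- A n  is  A_{n+1};   D n  is  D_{n+4};   E6, E7, E8.

data DynkinType : Set where
  A  : ℕ → DynkinType
  D  : ℕ → DynkinType
  E6 E7 E8 : DynkinType

rank : DynkinType → ℕ
rank (A n) = suc n
rank (D n) = n + 4
rank E6 = 6
rank E7 = 7
rank E8 = 8

coxeterNumber : DynkinType → ℕ
coxeterNumber (A n) = rank (A n) + 1
coxeterNumber (D n) = 2 * rank (D n) ∸ 2
coxeterNumber E6 = 12
coxeterNumber E7 = 18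
coxeterNumber E8 = 30

pathAdj : ℕ → ℕ → Bool
pathAdj i j = (suc i ≡ᵇ j) ∨ (suc j ≡ᵇ i)

-- on {0,..,r-1}: path 0 - 1 - ... - (r-2), plus vertex r-1 joined to b
branchAdj : ℕ → ℕ → ℕ → ℕ → Bool
branchAdj r b i j =
  ((i <ᵇ r ∸ 1) ∧ (j <ᵇ r ∸ 1) ∧ pathAdj i j)
  ∨ ((i ≡ᵇ r ∸ 1) ∧ (j ≡ᵇ b))
  ∨ ((j ≡ᵇ r ∸ 1) ∧ (i ≡ᵇ b))

dynkinAdj' : DynkinType → ℕ → ℕ → Bool
dynkinAdj' (A n) i j = pathAdj i j
dynkinAdj' (D n) i j = branchAdj (n + 4) (n + 1) i j
dynkinAdj' E6 i j = branchAdj 6 2 i j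
dynkinAdj' E7 i j = branchAdj 7 2 i j
dynkinAdj' E8 i j = branchAdj 8 2 i j

dynkinAdj : (T : DynkinType) → Graph (Fin (rank T))
dynkinAdj T i j = dynkinAdj' T (toℕ i) (toℕ j)

Reach : {V : Set} → Graph V → V → V → Set
Reach Γ = Star (λ x y → Γ x y ≡ true)

ComponentOfType : {V : Set} → Graph V → V → DynkinType → Set
ComponentOfType {V} Γ v T =
  Σ (Fin (rank T) → V) λ f →
    Injective _≡_ _≡_ f ×
    (∀ i → Reach Γ v (f i)) ×
    (∀ w → Reach Γ v w → ∃ λ i → f i ≡ w) ×
    (∀ i j → Γ (f i) (f j) ≡ dynkinAdj T i j)

AllComponentsADE : {V : Set} → Graph V → Set
AllComponentsADE {V} Γ = ∀ v → Σ DynkinType λ T → ComponentOfType Γ v T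

-- h is the common Coxeter number of all connected components of Γ
-- (and there is at least one component)
IsCommonCoxeterNumber : {V : Set} → Graph V → ℕ → Set
IsCommonCoxeterNumber {V} Γ h =
  V × (∀ v → Σ DynkinType λ T → ComponentOfType Γ v T × coxeterNumber T ≡ h)

-- Vertex set of a symmetric labeled bigraph with k swapped pairs and
-- m fixed points:  pos j = v_j^+,  neg j = v_j^-,  fix j = v_{k+1+j}.

data SV (k m : ℕ) : Set where
  pos : Fin k → SV k m
  neg : Fin k → SV k m
  fix : Fin m → SV k m

ι : {k m : ℕ} → SV k m → SV k m
ι (pos j) = neg j
ι (neg j) = pos j
ι (fix j) = fix j

sumFin : (n : ℕ) → (Fin n → ℕ) → ℕ
sumFin zero f = 0
sumFin (suc n) f = f Fin.zero + sumFin n (λ i → f (Fin.suc i))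

sumSV : {k m : ℕ} → (SV k m → ℕ) → ℕ
sumSV {k} {m} f = sumFin k (λ j → f (pos j)) + sumFin k (λ j → f (neg j)) + sumFin m (λ j → f (fix j))

𝟙 : Bool → ℕ
𝟙 true = 1
𝟙 false = 0

matProd : {k m : ℕ} → Graph (SV k m) → Graph (SV k m) → SV k m → SV k m → ℕ
matProd Γ Δ u v = sumSV (λ w → 𝟙 (Γ u w) * 𝟙 (Δ w v))

IsAdmissibleADE : {k m : ℕ} → Graph (SV k m) → Graph (SV k m) → Set
IsAdmissibleADE Γ Δ =
  IsBigraph Γ Δ × IsBipartite Γ Δ ×
  AllComponentsADE Γ × AllComponentsADE Δ ×
  (∀ u v → matProd Γ Δ u v ≡ matProd Δ Γ u v)

-- Symmetric labeled bigraph (the weight ρ is omitted).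

record SymLabeledBigraph (k m : ℕ) : Set where
  field
    Γ Δ   : Graph (SV k m)
    ε     : SV k m → Bool
    X     : Fin m → Fin m → Bool     -- X as a set of pairs of fixed vertices
    bigraph   : IsBigraph Γ Δ
    ε-properΓ : ProperColouring ε Γ
    ε-properΔ : ProperColouring ε Δ
    ι-Γ : ∀ u v → Γ (ι u) (ι v) ≡ Γ u v
    ι-Δ : ∀ u v → Δ (ι u) (ι v) ≡ Δ u v
    ι-ε : ∀ v → ε (ι v) ≡ ε v
    X-sym  : ∀ i j → X i j ≡ X j i
    X-edge : ∀ i j → X i j ≡ true → (Γ (fix i) (fix j) ∨ Δ (fix i) (fix j)) ≡ true

open SymLabeledBigraph public

DualRules : {k m : ℕ} → Graph (SV k m) → (Fin m → Fin m → Bool)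
          → Graph (SV m k) → (Fin k → Fin k → Bool) → Set
DualRules {k} {m} G X G* X* =
  (∀ (i j : Fin m) → (G (fix i) (fix j) ∧ X i j)
       ≡ (G* (pos i) (neg j) ∧ G* (neg i) (pos j))) ×
  (∀ (i j : Fin m) → (G (fix i) (fix j) ∧ not (X i j))
       ≡ (G* (pos i) (pos j) ∧ G* (neg i) (neg j))) ×
  (∀ (a : Fin k) (j : Fin m) → (G (pos a) (fix j) ∧ G (neg a) (fix j))
       ≡ (G* (pos j) (fix a) ∧ G* (neg j) (fix a))) ×
  (∀ (a b : Fin k) → (G (pos a) (pos b) ∧ G (neg a) (neg b))
       ≡ (G* (fix a) (fix b) ∧ not (X* a b))) ×
  (∀ (a b : Fin k) → (G (pos a) (neg b) ∧ G (neg a) (pos b))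
       ≡ (G* (fix a) (fix b) ∧ X* a b))

IsDual : {k m : ℕ} → SymLabeledBigraph k m → SymLabeledBigraph m k → Set
IsDual B B* = DualRules (Γ B) (X B) (Γ B*) (X B*) × DualRules (Δ B) (X B) (Δ B*) (X B*)

module Submission where

-- Write A for the adjacency operator of a graph and U_N for the Chebyshev
-- polynomials of the second kind (U_0 = 1, U_1 = t, U_{N+2} = t U_{N+1} − U_N).
-- A Dynkin diagram T of Coxeter number h is pinned down by two facts about
-- the integer vectors U_N(A_T) w:
--   (vanishing)    U_{h-1}(A_T) 𝟏 = 0;
--   (positivity)   for N < h − 1 some U_N(A_T) w is nonnegative and nonzero,
--                  so by self-adjointness U_N(A_T) kills no positive vector.
-- These are proved type by type: for A and D from the explicit sequence
-- U_N e₀ (for D it is a palindrome, which forces the vanishing), and for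
-- E₆, E₇, E₈ from certified tables of U_N 𝟏.  Restricting to components
-- transfers both facts to any graph whose components all have Coxeter
-- number h.  Finally, folding each swapped pair of B into the fixed vertex
-- of B* intertwines A_G on ι-even vectors with A_{G*}, so
-- U_{h-1}(A_{G*}) kills the positive vector fold 𝟏; hence h* ≤ h, and
-- h ≤ h* by the symmetry of duality.

open import Defs
open import Data.Nat using (ℕ)
open import Data.Product using (_×_)
open import Relation.Binary.PropositionalEquality using (_≡_)

open import Data.Nat as ℕ using (zero; suc; pred; _≡ᵇ_; _<ᵇ_; z≤n; s≤s)
import Data.Nat.Properties as ℕₚ
open import Data.Nat.Tactic.RingSolver using () renaming (solve-∀ to ℕ-solve-∀)
open import Data.Integer as ℤ using (ℤ; +_; _+_; _*_; _-_; -_; +≤+; +<+)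
import Data.Integer.Properties as ℤₚ
open import Data.Integer.Tactic.RingSolver using (solve-∀)
open import Data.Fin as Fin using (Fin; zero; suc; toℕ)
import Data.Fin.Properties as Finₚ
open import Data.Bool using (Bool; true; false; T; _∧_; _∨_; not)
open import Data.Bool.Properties using (T-≡; ∧-idem; ∧-zeroʳ; ∧-identityʳ; ∨-identityʳ)
open import Data.List using (List; []; _∷_)
open import Data.Product using (Σ-syntax; ∃; _,_; proj₁; proj₂)
open import Data.Sum using (_⊎_; inj₁; inj₂)
open import Data.Unit using (⊤; tt)
open import Data.Empty using (⊥-elim)
open import Function using (_∘_; id)
open import Function.Bundles using (Equivalence)
open import Function.Definitions using (Injective)
open import Relation.Nullary using (¬_; Dec; yes; no; does)
open import Relation.Nullary.Decidable using (map′; _×-dec_; toWitness)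
open import Relation.Binary.Definitions using (DecidableEquality)
open import Relation.Binary.PropositionalEquality
  using (_≢_; refl; sym; trans; cong; cong₂; subst; subst₂; module ≡-Reasoning)
import Relation.Binary.Construct.Closure.ReflexiveTransitive as Star
open ≡-Reasoning

Vect : Set → Set
Vect V = V → ℤ

infix 4 _≐_
_≐_ : {V : Set} → Vect V → Vect V → Set
x ≐ y = ∀ v → x v ≡ y v

𝟘 𝟏 : {V : Set} → Vect V
𝟘 _ = + 0
𝟏 _ = + 1

χ : Bool → ℤ
χ true = + 1
χ false = + 0

record Summation (V : Set) : Set where
  field
    sum      : Vect V → ℤ
    sum-cong : ∀ {f g} → f ≐ g → sum f ≡ sum g
    sum-+    : ∀ f g → sum (λ v → f v + g v) ≡ sum f + sum g
    sum-*    : ∀ c f → sum (λ v → c * f v) ≡ c * sum f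

  sum-𝟘 : ∀ {f} → f ≐ 𝟘 → sum f ≡ + 0
  sum-𝟘 {f} f≐0 = begin
    sum f                ≡⟨ sum-cong f≐0 ⟩
    sum (λ _ → + 0 * + 0) ≡⟨ sum-* (+ 0) 𝟘 ⟩
    + 0 * sum 𝟘          ≡⟨⟩
    + 0                  ∎

  sum-*ʳ : ∀ c f → sum (λ v → f v * c) ≡ sum f * c
  sum-*ʳ c f = begin
    sum (λ v → f v * c) ≡⟨ sum-cong (λ v → ℤₚ.*-comm (f v) c) ⟩
    sum (λ v → c * f v) ≡⟨ sum-* c f ⟩
    c * sum f           ≡⟨ ℤₚ.*-comm c (sum f) ⟩
    sum f * c           ∎

  sum-- : ∀ f g → sum (λ v → f v - g v) ≡ sum f - sum g
  sum-- f g = begin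
    sum (λ v → f v - g v)             ≡⟨ sum-cong (λ v → cong (_+_ (f v)) (sym (ℤₚ.-1*i≡-i (g v)))) ⟩
    sum (λ v → f v + ℤ.-1ℤ * g v)      ≡⟨ sum-+ f _ ⟩
    sum f + sum (λ v → ℤ.-1ℤ * g v)    ≡⟨ cong (_+_ (sum f)) (trans (sum-* ℤ.-1ℤ g) (ℤₚ.-1*i≡-i (sum g))) ⟩
    sum f - sum g                     ∎

open Summation public

ΣF : (n : ℕ) → Vect (Fin n) → ℤ
ΣF zero f = + 0
ΣF (suc n) f = f zero + ΣF n (f ∘ suc)

finSum : (n : ℕ) → Summation (Fin n)
finSum n = record { sum = ΣF n ; sum-cong = cong′ n ; sum-+ = additive n ; sum-* = homogeneous n }
  where
    cong′ : ∀ n {f g} → f ≐ g → ΣF n f ≡ ΣF n g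
    cong′ zero f≐g = refl
    cong′ (suc n) f≐g = cong₂ _+_ (f≐g zero) (cong′ n (f≐g ∘ suc))

    additive : ∀ n f g → ΣF n (λ v → f v + g v) ≡ ΣF n f + ΣF n g
    additive zero f g = refl
    additive (suc n) f g =
      trans (cong (_+_ (f zero + g zero)) (additive n (f ∘ suc) (g ∘ suc)))
            (interchange (f zero) (g zero) _ _)
      where interchange : ∀ a b c d → a + b + (c + d) ≡ a + c + (b + d)
            interchange = solve-∀

    homogeneous : ∀ n c f → ΣF n (λ v → c * f v) ≡ c * ΣF n f
    homogeneous zero c f = sym (ℤₚ.*-zeroʳ c)
    homogeneous (suc n) c f =
      trans (cong (_+_ (c * f zero)) (homogeneous n c (f ∘ suc)))
            (sym (ℤₚ.*-distribˡ-+ c (f zero) _))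

-- Summation over a type covered by the images of i and j (disjointly, in
-- every use below): the sum of the two partial sums.
glue : {A B V : Set} → Summation A → Summation B → (A → V) → (B → V) → Summation V
glue S T i j = record
  { sum = λ f → sum S (f ∘ i) + sum T (f ∘ j)
  ; sum-cong = λ f≐g → cong₂ _+_ (sum-cong S (f≐g ∘ i)) (sum-cong T (f≐g ∘ j))
  ; sum-+ = λ f g → trans (cong₂ _+_ (sum-+ S (f ∘ i) (g ∘ i)) (sum-+ T (f ∘ j) (g ∘ j)))
                          (interchange (sum S (f ∘ i)) _ _ _)
  ; sum-* = λ c f → trans (cong₂ _+_ (sum-* S c (f ∘ i)) (sum-* T c (f ∘ j)))
                          (sym (ℤₚ.*-distribˡ-+ c _ _))
  }
  where interchange : ∀ a b c d → a + b + (c + d) ≡ a + c + (b + d)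
        interchange = solve-∀

sum-ΣF-comm : ∀ {V} (S : Summation V) n (F : V → Fin n → ℤ) →
  sum S (λ v → ΣF n (F v)) ≡ ΣF n (λ i → sum S (λ v → F v i))
sum-ΣF-comm S zero F = sum-𝟘 S (λ _ → refl)
sum-ΣF-comm S (suc n) F =
  trans (sum-+ S _ _) (cong (_+_ (sum S (λ v → F v zero))) (sum-ΣF-comm S n (λ v i → F v (suc i))))

ΣF-δ : ∀ n (u : Fin n) (z : Vect (Fin n)) → ΣF n (λ v → χ (does (u Fin.≟ v)) * z v) ≡ z u
ΣF-δ (suc n) zero z = begin
  + 1 * z zero + ΣF n (λ v → + 0 * z (suc v)) ≡⟨ cong₂ _+_ (ℤₚ.*-identityˡ (z zero)) (sum-𝟘 (finSum n) (λ _ → refl)) ⟩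
  z zero + + 0                                ≡⟨ ℤₚ.+-identityʳ (z zero) ⟩
  z zero                                      ∎
ΣF-δ (suc n) (suc u) z = begin
  + 0 * z zero + ΣF n (λ v → χ (does (u Fin.≟ v)) * z (suc v)) ≡⟨ cong (_+_ (+ 0)) (ΣF-δ n u (z ∘ suc)) ⟩
  + 0 + z (suc u)                                            ≡⟨ ℤₚ.+-identityˡ (z (suc u)) ⟩
  z (suc u)                                                  ∎

does-sym : ∀ {A : Set} (_≟_ : DecidableEquality A) (a b : A) → does (a ≟ b) ≡ does (b ≟ a)
does-sym _≟_ a b with a ≟ b | b ≟ a
... | yes _ | yes _ = refl
... | no _ | no _ = refl
... | yes a≡b | no b≢a = ⊥-elim (b≢a (sym a≡b))
... | no a≢b | yes b≡a = ⊥-elim (a≢b (sym b≡a))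

does-injective : ∀ {A B : Set} (_≟ᴬ_ : DecidableEquality A) (_≟ᴮ_ : DecidableEquality B)
  {f : A → B} → Injective _≡_ _≡_ f → ∀ a b → does (f a ≟ᴮ f b) ≡ does (a ≟ᴬ b)
does-injective _≟ᴬ_ _≟ᴮ_ {f} inj a b with f a ≟ᴮ f b | a ≟ᴬ b
... | yes _ | yes _ = refl
... | no _ | no _ = refl
... | yes fa≡fb | no a≢b = ⊥-elim (a≢b (inj fa≡fb))
... | no fa≢fb | yes a≡b = ⊥-elim (fa≢fb (cong f a≡b))

module _ {V : Set} (S : Summation V) (_≟_ : DecidableEquality V)
  (sum-δ : ∀ u (z : Vect V) → sum S (λ w → χ (does (u ≟ w)) * z w) ≡ z u) where

  sum-image : ∀ {n} (f : Fin n → V) → Injective _≡_ _≡_ f → (g : Vect V) →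
    (∀ w → g w ≡ + 0 ⊎ ∃ λ j → f j ≡ w) → sum S g ≡ ΣF n (g ∘ f)
  sum-image {n} f inj g supported = begin
    sum S g                                            ≡⟨ sum-cong S expand ⟩
    sum S (λ w → ΣF n (λ j → χ (does (f j ≟ w)) * g w)) ≡⟨ sum-ΣF-comm S n _ ⟩
    ΣF n (λ j → sum S (λ w → χ (does (f j ≟ w)) * g w)) ≡⟨ sum-cong (finSum n) (λ j → sum-δ (f j) g) ⟩
    ΣF n (g ∘ f)                                       ∎
    where
      expand : ∀ w → g w ≡ ΣF n (λ j → χ (does (f j ≟ w)) * g w)
      expand w with supported w
      ... | inj₁ gw≡0 rewrite gw≡0 = sym (sum-𝟘 (finSum n) (λ j → ℤₚ.*-zeroʳ (χ (does (f j ≟ w)))))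
      ... | inj₂ (j₀ , refl) = sym (begin
        ΣF n (λ j → χ (does (f j ≟ f j₀)) * g (f j₀)) ≡⟨ sum-cong (finSum n) (λ j → cong (λ b → χ b * g (f j₀))
                                                          (trans (does-injective Fin._≟_ _≟_ inj j j₀) (does-sym Fin._≟_ j j₀))) ⟩
        ΣF n (λ j → χ (does (j₀ Fin.≟ j)) * g (f j₀))  ≡⟨ ΣF-δ n j₀ (λ _ → g (f j₀)) ⟩
        g (f j₀)                                     ∎)

module Adjacency {V : Set} (S : Summation V) (G : Graph V) where

  act : Vect V → Vect V
  act x v = sum S (λ w → χ (G v w) * x w)

  U : ℕ → Vect V → Vect V
  U zero x = x
  U (suc zero) x = act x
  U (suc (suc n)) x v = act (U (suc n) x) v - U n x v

  U-at : ∀ {i j} → i ≡ j → ∀ x → U i x ≐ U j x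
  U-at refl x v = refl

  act-cong : ∀ {x y} → x ≐ y → act x ≐ act y
  act-cong x≐y v = sum-cong S (λ w → cong (χ (G v w) *_) (x≐y w))

  act-sub : ∀ x y → act (λ v → x v - y v) ≐ (λ v → act x v - act y v)
  act-sub x y v =
    trans (sum-cong S (λ w → distrib (χ (G v w)) (x w) (y w))) (sum-- S _ _)
    where distrib : ∀ a b c → a * (b - c) ≡ a * b - a * c
          distrib = solve-∀

  act-lin : ∀ a b x y → act (λ v → a * x v + b * y v) ≐ (λ v → a * act x v + b * act y v)
  act-lin a b x y v = begin
    sum S (λ w → χ (G v w) * (a * x w + b * y w))
      ≡⟨ sum-cong S (λ w → distrib (χ (G v w)) a b (x w) (y w)) ⟩
    sum S (λ w → a * (χ (G v w) * x w) + b * (χ (G v w) * y w))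
      ≡⟨ sum-+ S _ _ ⟩
    sum S (λ w → a * (χ (G v w) * x w)) + sum S (λ w → b * (χ (G v w) * y w))
      ≡⟨ cong₂ _+_ (sum-* S a _) (sum-* S b _) ⟩
    a * act x v + b * act y v ∎
    where distrib : ∀ g a b x y → g * (a * x + b * y) ≡ a * (g * x) + b * (g * y)
          distrib = solve-∀

  U-cong : ∀ n {x y} → x ≐ y → U n x ≐ U n y
  U-cong zero x≐y = x≐y
  U-cong (suc zero) x≐y = act-cong x≐y
  U-cong (suc (suc n)) x≐y v = cong₂ _-_ (act-cong (U-cong (suc n) x≐y) v) (U-cong n x≐y v)

  U-lin : ∀ n a b x y → U n (λ v → a * x v + b * y v) ≐ (λ v → a * U n x v + b * U n y v)
  U-lin zero a b x y v = refl
  U-lin (suc zero) a b x y = act-lin a b x y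
  U-lin (suc (suc n)) a b x y v = begin
    act (U (suc n) (λ v → a * x v + b * y v)) v - U n (λ v → a * x v + b * y v) v
      ≡⟨ cong₂ _-_ (act-cong (U-lin (suc n) a b x y) v) (U-lin n a b x y v) ⟩
    act (λ v → a * U (suc n) x v + b * U (suc n) y v) v - (a * U n x v + b * U n y v)
      ≡⟨ cong (_- (a * U n x v + b * U n y v)) (act-lin a b (U (suc n) x) (U (suc n) y) v) ⟩
    (a * act (U (suc n) x) v + b * act (U (suc n) y) v) - (a * U n x v + b * U n y v)
      ≡⟨ regroup a b _ _ _ _ ⟩
    a * U (suc (suc n)) x v + b * U (suc (suc n)) y v ∎
    where regroup : ∀ a b p q r s → (a * p + b * q) - (a * r + b * s) ≡ a * (p - r) + b * (q - s)
          regroup = solve-∀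

  U-𝟘 : ∀ n → U n 𝟘 ≐ 𝟘
  U-𝟘 n v = U-lin n (+ 0) (+ 0) 𝟘 𝟘 v

  U-+ : ∀ n x y → U n (λ v → x v + y v) ≐ (λ v → U n x v + U n y v)
  U-+ n x y v = begin
    U n (λ v → x v + y v) v                  ≡⟨ U-cong n (λ w → unit (x w) (y w)) v ⟩
    U n (λ v → + 1 * x v + + 1 * y v) v      ≡⟨ U-lin n (+ 1) (+ 1) x y v ⟩
    + 1 * U n x v + + 1 * U n y v            ≡⟨ sym (unit (U n x v) (U n y v)) ⟩
    U n x v + U n y v                        ∎
    where unit : ∀ a b → a + b ≡ + 1 * a + + 1 * b
          unit = solve-∀

  U-- : ∀ n x y → U n (λ v → x v - y v) ≐ (λ v → U n x v - U n y v)
  U-- n x y v = begin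
    U n (λ v → x v - y v) v                  ≡⟨ U-cong n (λ w → unit (x w) (y w)) v ⟩
    U n (λ v → + 1 * x v + - + 1 * y v) v    ≡⟨ U-lin n (+ 1) (- + 1) x y v ⟩
    + 1 * U n x v + - + 1 * U n y v          ≡⟨ sym (unit (U n x v) (U n y v)) ⟩
    U n x v - U n y v                        ∎
    where unit : ∀ a b → a - b ≡ + 1 * a + - + 1 * b
          unit = solve-∀

module Intertwining {V W : Set} (S : Summation V) (T : Summation W) (G : Graph V) (H : Graph W)
  (P : Vect V → Set) (Φ : Vect V → Vect W)
  (P-act : ∀ {x} → P x → P (Adjacency.act S G x))
  (P-sub : ∀ {x y} → P x → P y → P (λ v → x v - y v))
  (Φ-cong : ∀ {x y} → x ≐ y → Φ x ≐ Φ y)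
  (Φ-sub : ∀ x y → Φ (λ v → x v - y v) ≐ (λ w → Φ x w - Φ y w))
  (Φ-act : ∀ {x} → P x → Φ (Adjacency.act S G x) ≐ Adjacency.act T H (Φ x)) where
  private
    module A = Adjacency S G
    module B = Adjacency T H

  intertwine : ∀ {x} → P x → ∀ n → P (A.U n x) × (Φ (A.U n x) ≐ B.U n (Φ x))
  intertwine px zero = px , λ _ → refl
  intertwine px (suc zero) = P-act px , Φ-act px
  intertwine px (suc (suc n)) with intertwine px n | intertwine px (suc n)
  ... | p₀ , e₀ | p₁ , e₁ =
    P-sub (P-act p₁) p₀ ,
    λ w → trans (Φ-sub _ _ w) (cong₂ _-_ (trans (Φ-act p₁ w) (B.act-cong e₁ w)) (e₀ w))

module Chebyshev {V : Set} (S : Summation V) (G : Graph V) where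
  open Adjacency S G public

  private
    Always : Vect V → Set
    Always _ = ⊤

  U-act : ∀ x n → U n (act x) ≐ act (U n x)
  U-act x n v = sym (proj₂ (intertwine tt n) v)
    where open Intertwining S S G G Always act (λ _ → tt) (λ _ _ → tt) act-cong act-sub (λ _ _ → refl)

  U-comm : ∀ x m n → U m (U n x) ≐ U n (U m x)
  U-comm x m n = proj₂ (intertwine tt n)
    where open Intertwining S S G G Always (U m) (λ _ → tt) (λ _ _ → tt) (U-cong m) (U-- m) (λ {x} _ → U-act x m)

  Σ< : ℕ → (ℕ → Vect V) → Vect V
  Σ< zero F v = + 0
  Σ< (suc M) F v = Σ< M F v + F M v

  Σ<-cong : ∀ M {F G} → (∀ a → a ℕ.< M → F a ≐ G a) → Σ< M F ≐ Σ< M G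
  Σ<-cong zero F≐G v = refl
  Σ<-cong (suc M) F≐G v = cong₂ _+_ (Σ<-cong M (λ a a<M → F≐G a (ℕₚ.m<n⇒m<1+n a<M)) v) (F≐G M ℕₚ.≤-refl v)

  Σ<-𝟘 : ∀ M {F} → (∀ a → F a ≐ 𝟘) → Σ< M F ≐ 𝟘
  Σ<-𝟘 zero F≐0 v = refl
  Σ<-𝟘 (suc M) F≐0 v = cong₂ _+_ (Σ<-𝟘 M F≐0 v) (F≐0 M v)

  U-Σ< : ∀ n M F → U n (Σ< M F) ≐ Σ< M (λ a → U n (F a))
  U-Σ< n zero F = U-𝟘 n
  U-Σ< n (suc M) F v = trans (U-+ n (Σ< M F) (F M) v) (cong (_+ U n (F M) v) (U-Σ< n M F v))

  cyclic-vanishing : ∀ {x y} M H → y ≐ Σ< M (λ a → U a x) → U H x ≐ 𝟘 → U H y ≐ 𝟘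
  cyclic-vanishing {x} {y} M H y≐ Hx≐0 v = begin
    U H y v                      ≡⟨ U-cong H y≐ v ⟩
    U H (Σ< M (λ a → U a x)) v   ≡⟨ U-Σ< H M _ v ⟩
    Σ< M (λ a → U H (U a x)) v   ≡⟨ Σ<-𝟘 M (λ a w → trans (U-comm x H a w) (trans (U-cong a Hx≐0 w) (U-𝟘 a w))) v ⟩
    + 0 ∎

  U-unique : ∀ {x} (c : ℕ → Vect V) M → c 0 ≐ x → c 1 ≐ act x →
    (∀ j → j ℕ.< M → c (suc (suc j)) ≐ (λ v → act (c (suc j)) v - c j v)) →
    ∀ j → j ℕ.≤ suc M → U j x ≐ c j
  U-unique c M c₀ c₁ step zero _ v = sym (c₀ v)
  U-unique c M c₀ c₁ step (suc zero) _ v = sym (c₁ v)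
  U-unique c M c₀ c₁ step (suc (suc j)) (s≤s j<M) v =
    trans (cong₂ _-_ (act-cong (U-unique c M c₀ c₁ step (suc j) (ℕₚ.<⇒≤ (s≤s j<M))) v)
                     (U-unique c M c₀ c₁ step j (ℕₚ.≤-trans (ℕₚ.n≤1+n j) (ℕₚ.<⇒≤ (s≤s j<M))) v))
          (sym (step j j<M v))

  palindrome : ∀ {x} k → U (suc (suc k)) x ≐ U k x →
    ∀ j c → c ℕ.+ j ≡ suc k → U c x ≐ U (suc k ℕ.+ j) x
  palindrome {x} k turn zero c c≡K =
    U-at (trans (trans (sym (ℕₚ.+-identityʳ c)) c≡K) (sym (ℕₚ.+-identityʳ (suc k)))) x
  palindrome {x} k turn (suc zero) c c+1≡K v = begin
    U c x v               ≡⟨ U-at (ℕₚ.suc-injective (trans (ℕₚ.+-comm 1 c) c+1≡K)) x v ⟩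
    U k x v               ≡⟨ sym (turn v) ⟩
    U (suc (suc k)) x v   ≡⟨ U-at (ℕₚ.+-comm 1 (suc k)) x v ⟩
    U (suc k ℕ.+ 1) x v   ∎
  palindrome {x} k turn (suc (suc j)) c eq v = begin
    U c x v
      ≡⟨ sym (cancel (act (U (suc c) x) v) (U c x v)) ⟩
    act (U (suc c) x) v - U (suc (suc c)) x v
      ≡⟨ cong₂ _-_ (act-cong (palindrome k turn (suc j) (suc c) eq₁) v) (palindrome k turn j (suc (suc c)) eq₀ v) ⟩
    act (U (suc k ℕ.+ suc j) x) v - U (suc k ℕ.+ j) x v
      ≡⟨ cong (_- U (suc k ℕ.+ j) x v) (act-cong (U-at (ℕₚ.+-suc (suc k) j) x) v) ⟩
    U (suc (suc (suc k ℕ.+ j))) x v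
      ≡⟨ U-at (sym (trans (ℕₚ.+-suc (suc k) (suc j)) (cong suc (ℕₚ.+-suc (suc k) j)))) x v ⟩
    U (suc k ℕ.+ suc (suc j)) x v ∎
    where
      cancel : ∀ a b → a - (a - b) ≡ b
      cancel = solve-∀
      eq₁ : suc c ℕ.+ suc j ≡ suc k
      eq₁ = trans (sym (ℕₚ.+-suc c (suc j))) eq
      eq₀ : suc (suc c) ℕ.+ j ≡ suc k
      eq₀ = trans (sym (trans (ℕₚ.+-suc c (suc j)) (cong suc (ℕₚ.+-suc c j)))) eq

  palindrome-vanishes : ∀ {x} k → U (suc (suc k)) x ≐ U k x → U (suc (suc k ℕ.+ suc k)) x ≐ 𝟘
  palindrome-vanishes {x} k turn v = begin
    act (U (suc k ℕ.+ suc k) x) v - U (k ℕ.+ suc k) x v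
      ≡⟨ cong₂ _-_ (act-cong (λ w → sym (palindrome k turn (suc k) 0 refl w)) v)
                   (trans (U-at (ℕₚ.+-suc k k) x v) (sym (palindrome k turn k 1 refl v))) ⟩
    act x v - act x v
      ≡⟨ ℤₚ.+-inverseʳ (act x v) ⟩
    + 0 ∎

module SelfAdjoint {n : ℕ} (G : Graph (Fin n)) (G-sym : ∀ i j → G i j ≡ G j i) where
  open Chebyshev (finSum n) G

  inner : Vect (Fin n) → Vect (Fin n) → ℤ
  inner x y = ΣF n (λ v → x v * y v)

  inner-congʳ : ∀ x {y z} → y ≐ z → inner x y ≡ inner x z
  inner-congʳ x y≐z = sum-cong (finSum n) (λ v → cong (x v *_) (y≐z v))

  inner-subˡ : ∀ x y z → inner (λ v → x v - y v) z ≡ inner x z - inner y z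
  inner-subˡ x y z = trans (sum-cong (finSum n) (λ v → distrib (x v) (y v) (z v))) (sum-- (finSum n) _ _)
    where distrib : ∀ a b c → (a - b) * c ≡ a * c - b * c
          distrib = solve-∀

  inner-subʳ : ∀ x y z → inner x (λ v → y v - z v) ≡ inner x y - inner x z
  inner-subʳ x y z = trans (sum-cong (finSum n) (λ v → distrib (x v) (y v) (z v))) (sum-- (finSum n) _ _)
    where distrib : ∀ a b c → a * (b - c) ≡ a * b - a * c
          distrib = solve-∀

  act-self-adjoint : ∀ x y → inner (act x) y ≡ inner x (act y)
  act-self-adjoint x y = begin
    ΣF n (λ v → ΣF n (λ w → χ (G v w) * x w) * y v)
      ≡⟨ sum-cong (finSum n) (λ v → sym (sum-*ʳ (finSum n) (y v) _)) ⟩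
    ΣF n (λ v → ΣF n (λ w → χ (G v w) * x w * y v))
      ≡⟨ sum-ΣF-comm (finSum n) n _ ⟩
    ΣF n (λ w → ΣF n (λ v → χ (G v w) * x w * y v))
      ≡⟨ sum-cong (finSum n) (λ w → sum-cong (finSum n) (λ v →
           trans (cong (λ b → χ b * x w * y v) (G-sym v w)) (reorder (χ (G w v)) (x w) (y v)))) ⟩
    ΣF n (λ w → ΣF n (λ v → x w * (χ (G w v) * y v)))
      ≡⟨ sum-cong (finSum n) (λ w → sum-* (finSum n) (x w) _) ⟩
    inner x (act y) ∎
    where reorder : ∀ a b c → a * b * c ≡ b * (a * c)
          reorder = solve-∀

  U-self-adjoint : ∀ N x y → inner (U N x) y ≡ inner x (U N y)
  U-self-adjoint zero x y = refl
  U-self-adjoint (suc zero) x y = act-self-adjoint x y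
  U-self-adjoint (suc (suc N)) x y = begin
    inner (λ v → act (U (suc N) x) v - U N x v) y
      ≡⟨ inner-subˡ (act (U (suc N) x)) (U N x) y ⟩
    inner (act (U (suc N) x)) y - inner (U N x) y
      ≡⟨ cong₂ _-_ (act-self-adjoint (U (suc N) x) y) (U-self-adjoint N x y) ⟩
    inner (U (suc N) x) (act y) - inner x (U N y)
      ≡⟨ cong (_- inner x (U N y)) (trans (U-self-adjoint (suc N) x (act y)) (inner-congʳ x (U-act y (suc N)))) ⟩
    inner x (act (U (suc N) y)) - inner x (U N y)
      ≡⟨ sym (inner-subʳ x (act (U (suc N) y)) (U N y)) ⟩
    inner x (U (suc (suc N)) y) ∎

Semipositive : ∀ {n} → Vect (Fin n) → Set
Semipositive x = (∀ v → + 0 ℤ.≤ x v) × ∃ λ v → + 0 ℤ.< x v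

*-nonneg : ∀ {a b} → + 0 ℤ.< a → + 0 ℤ.≤ b → + 0 ℤ.≤ a * b
*-nonneg {a} {+ zero} _ _ = subst (+ 0 ℤ.≤_) (sym (ℤₚ.*-zeroʳ a)) (+≤+ z≤n)
*-nonneg {+ suc _} {+ suc _} _ _ = +≤+ z≤n
*-nonneg {+ zero} {+ suc _} (+<+ ()) _

*-pos : ∀ {a b} → + 0 ℤ.< a → + 0 ℤ.< b → + 0 ℤ.< a * b
*-pos {+ suc _} {+ suc _} _ _ = +<+ (s≤s z≤n)
*-pos {+ zero} (+<+ ()) _
*-pos {_} {+ zero} _ (+<+ ())

inner-positive : ∀ n (y w : Vect (Fin n)) → (∀ v → + 0 ℤ.< y v) → Semipositive w →
  + 0 ℤ.< ΣF n (λ v → y v * w v)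
inner-positive (suc n) y w y>0 (w≥0 , zero , w₀>0) =
  ℤₚ.+-mono-<-≤ (*-pos (y>0 zero) w₀>0) (inner-nonneg n (y ∘ suc) (w ∘ suc) (y>0 ∘ suc) (w≥0 ∘ suc))
  where
    inner-nonneg : ∀ n (y w : Vect (Fin n)) → (∀ v → + 0 ℤ.< y v) → (∀ v → + 0 ℤ.≤ w v) →
      + 0 ℤ.≤ ΣF n (λ v → y v * w v)
    inner-nonneg zero y w _ _ = +≤+ z≤n
    inner-nonneg (suc n) y w y>0 w≥0 =
      ℤₚ.+-mono-≤ (*-nonneg (y>0 zero) (w≥0 zero)) (inner-nonneg n (y ∘ suc) (w ∘ suc) (y>0 ∘ suc) (w≥0 ∘ suc))
inner-positive (suc n) y w y>0 (w≥0 , suc v₀ , w₀>0) =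
  ℤₚ.+-mono-≤-< (*-nonneg (y>0 zero) (w≥0 zero)) (inner-positive n (y ∘ suc) (w ∘ suc) (y>0 ∘ suc) (w≥0 ∘ suc , v₀ , w₀>0))

χ-nonneg : ∀ b → + 0 ℤ.≤ χ b
χ-nonneg true = +≤+ z≤n
χ-nonneg false = +≤+ z≤n

Semipositive-cong : ∀ {n} {x y : Vect (Fin n)} → x ≐ y → Semipositive y → Semipositive x
Semipositive-cong x≐y (y≥0 , v , yv>0) =
  (λ w → subst (+ 0 ℤ.≤_) (sym (x≐y w)) (y≥0 w)) , v , subst (+ 0 ℤ.<_) (sym (x≐y v)) yv>0

Semipositive-+ : ∀ {n} {x y : Vect (Fin n)} → Semipositive x → (∀ v → + 0 ℤ.≤ y v) →
  Semipositive (λ v → x v + y v)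
Semipositive-+ (x≥0 , v , xv>0) y≥0 =
  (λ w → ℤₚ.+-mono-≤ (x≥0 w) (y≥0 w)) , v , ℤₚ.+-mono-<-≤ xv>0 (y≥0 v)

module Restriction {V : Set} (S : Summation V) (_≟_ : DecidableEquality V)
  (sum-δ : ∀ u (z : Vect V) → sum S (λ w → χ (does (u ≟ w)) * z w) ≡ z u)
  (G : Graph V) {v₀ : V} {T : DynkinType} (C : ComponentOfType G v₀ T) where

  private
    module A = Adjacency S G
    module D = Adjacency (finSum (rank T)) (dynkinAdj T)

  embedding : Fin (rank T) → V
  embedding = proj₁ C

  private
    f : Fin (rank T) → V
    f = embedding
    injective : Injective _≡_ _≡_ f
    injective = proj₁ (proj₂ C)
    reachable : ∀ i → Reach G v₀ (f i)
    reachable = proj₁ (proj₂ (proj₂ C))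
    surjective : ∀ w → Reach G v₀ w → ∃ λ i → f i ≡ w
    surjective = proj₁ (proj₂ (proj₂ (proj₂ C)))
    adjacency : ∀ i j → G (f i) (f j) ≡ dynkinAdj T i j
    adjacency = proj₂ (proj₂ (proj₂ (proj₂ C)))

  base-point : ∃ λ i → f i ≡ v₀
  base-point = surjective v₀ Star.ε

  diagram-symmetric : (∀ u v → G u v ≡ G v u) → ∀ i j → dynkinAdj T i j ≡ dynkinAdj T j i
  diagram-symmetric G-sym i j = trans (sym (adjacency i j)) (trans (G-sym (f i) (f j)) (adjacency j i))

  restrict-act : ∀ x i → A.act x (f i) ≡ D.act (x ∘ f) i
  restrict-act x i = begin
    sum S (λ w → χ (G (f i) w) * x w)
      ≡⟨ sum-image S _≟_ sum-δ f injective _ neighbours-in-component ⟩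
    ΣF (rank T) (λ j → χ (G (f i) (f j)) * x (f j))
      ≡⟨ sum-cong (finSum (rank T)) (λ j → cong (λ b → χ b * x (f j)) (adjacency i j)) ⟩
    D.act (x ∘ f) i ∎
    where
      neighbours-in-component : ∀ w → χ (G (f i) w) * x w ≡ + 0 ⊎ ∃ λ j → f j ≡ w
      neighbours-in-component w with G (f i) w in edge
      ... | false = inj₁ refl
      ... | true = inj₂ (surjective w (reachable i Star.◅◅ (edge Star.◅ Star.ε)))

  restrict-U : ∀ x N → (A.U N x ∘ f) ≐ D.U N (x ∘ f)
  restrict-U x N = proj₂ (intertwine tt N)
    where open Intertwining S (finSum (rank T)) G (dynkinAdj T) (λ _ → ⊤) (_∘ f)
                 (λ _ → tt) (λ _ _ → tt) (λ x≐y → x≐y ∘ f) (λ _ _ _ → refl) (λ {x} _ → restrict-act x)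

_≟ˢ_ : ∀ {k m} → DecidableEquality (SV k m)
pos a ≟ˢ pos b = map′ (cong pos) (λ { refl → refl }) (a Fin.≟ b)
neg a ≟ˢ neg b = map′ (cong neg) (λ { refl → refl }) (a Fin.≟ b)
fix a ≟ˢ fix b = map′ (cong fix) (λ { refl → refl }) (a Fin.≟ b)
pos _ ≟ˢ neg _ = no λ ()
pos _ ≟ˢ fix _ = no λ ()
neg _ ≟ˢ pos _ = no λ ()
neg _ ≟ˢ fix _ = no λ ()
fix _ ≟ˢ pos _ = no λ ()
fix _ ≟ˢ neg _ = no λ ()

svSum : ∀ k m → Summation (SV k m)
svSum k m = glue (glue (finSum k) (finSum k) pos neg) (finSum m) id fix

sv-δ : ∀ {k m} (u : SV k m) (z : Vect (SV k m)) → sum (svSum k m) (λ w → χ (does (u ≟ˢ w)) * z w) ≡ z u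
sv-δ {k} {m} (pos a) z = begin
  ΣF k (λ b → χ (does (a Fin.≟ b)) * z (pos b)) + ΣF k (λ _ → + 0) + ΣF m (λ _ → + 0)
    ≡⟨ cong₂ _+_ (cong₂ _+_ (ΣF-δ k a (z ∘ pos)) (zeros k)) (zeros m) ⟩
  z (pos a) + + 0 + + 0
    ≡⟨ trans (ℤₚ.+-identityʳ _) (ℤₚ.+-identityʳ _) ⟩
  z (pos a) ∎
  where zeros : ∀ n → ΣF n (λ _ → + 0) ≡ + 0
        zeros n = sum-𝟘 (finSum n) (λ _ → refl)
sv-δ {k} {m} (neg a) z = begin
  ΣF k (λ _ → + 0) + ΣF k (λ b → χ (does (a Fin.≟ b)) * z (neg b)) + ΣF m (λ _ → + 0)
    ≡⟨ cong₂ _+_ (cong₂ _+_ (zeros k) (ΣF-δ k a (z ∘ neg))) (zeros m) ⟩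
  + 0 + z (neg a) + + 0
    ≡⟨ trans (ℤₚ.+-identityʳ _) (ℤₚ.+-identityˡ _) ⟩
  z (neg a) ∎
  where zeros : ∀ n → ΣF n (λ _ → + 0) ≡ + 0
        zeros n = sum-𝟘 (finSum n) (λ _ → refl)
sv-δ {k} {m} (fix a) z = begin
  ΣF k (λ _ → + 0) + ΣF k (λ _ → + 0) + ΣF m (λ b → χ (does (a Fin.≟ b)) * z (fix b))
    ≡⟨ cong₂ _+_ (cong₂ _+_ (zeros k) (zeros k)) (ΣF-δ m a (z ∘ fix)) ⟩
  + 0 + + 0 + z (fix a)
    ≡⟨ ℤₚ.+-identityˡ _ ⟩
  z (fix a) ∎
  where zeros : ∀ n → ΣF n (λ _ → + 0) ≡ + 0
        zeros n = sum-𝟘 (finSum n) (λ _ → refl)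

sum-ι : ∀ {k m} (f : Vect (SV k m)) → sum (svSum k m) (f ∘ ι) ≡ sum (svSum k m) f
sum-ι {k} {m} f = cong (_+ ΣF m (f ∘ fix)) (ℤₚ.+-comm (ΣF k (f ∘ neg)) (ΣF k (f ∘ pos)))

≡ᵇ-refl : ∀ n → (n ≡ᵇ n) ≡ true
≡ᵇ-refl n = Equivalence.to T-≡ (ℕₚ.≡⇒≡ᵇ n n refl)

≡ᵇ-≢ : ∀ {m n} → m ≢ n → (m ≡ᵇ n) ≡ false
≡ᵇ-≢ {m} {n} m≢n with m ≡ᵇ n in eq
... | false = refl
... | true = ⊥-elim (m≢n (ℕₚ.≡ᵇ⇒≡ m n (subst T (sym eq) tt)))

<ᵇ-true : ∀ {m n} → m ℕ.< n → (m <ᵇ n) ≡ true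
<ᵇ-true m<n = Equivalence.to T-≡ (ℕₚ.<⇒<ᵇ m<n)

<ᵇ-irrefl : ∀ n → (n <ᵇ n) ≡ false
<ᵇ-irrefl zero = refl
<ᵇ-irrefl (suc n) = <ᵇ-irrefl n

-- χ(k = a) summed over a < M is χ(k < M).
Σ-δ-upTo : ∀ k M → χ (k <ᵇ M) + χ (k ≡ᵇ M) ≡ χ (k <ᵇ suc M)
Σ-δ-upTo zero zero = refl
Σ-δ-upTo zero (suc M) = refl
Σ-δ-upTo (suc k) zero = refl
Σ-δ-upTo (suc k) (suc M) = Σ-δ-upTo k M

ΣF-δℕ : ∀ L (g : ℕ → ℤ) a → ΣF L (λ j → g (toℕ j) * χ (toℕ j ≡ᵇ a)) ≡ χ (a <ᵇ L) * g a
ΣF-δℕ zero g a = refl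
ΣF-δℕ (suc L) g zero = begin
  g 0 * + 1 + ΣF L (λ j → g (suc (toℕ j)) * + 0) ≡⟨ cong₂ _+_ (ℤₚ.*-identityʳ (g 0)) (sum-𝟘 (finSum L) (λ j → ℤₚ.*-zeroʳ (g (suc (toℕ j))))) ⟩
  g 0 + + 0                                     ≡⟨ ℤₚ.+-identityʳ (g 0) ⟩
  g 0                                           ≡⟨ sym (ℤₚ.*-identityˡ (g 0)) ⟩
  + 1 * g 0                                     ∎
ΣF-δℕ (suc L) g (suc a) = begin
  g 0 * + 0 + ΣF L (λ j → g (suc (toℕ j)) * χ (toℕ j ≡ᵇ a)) ≡⟨ cong₂ _+_ (ℤₚ.*-zeroʳ (g 0)) (ΣF-δℕ L (g ∘ suc) a) ⟩
  + 0 + χ (a <ᵇ L) * g (suc a)                            ≡⟨ ℤₚ.+-identityˡ _ ⟩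
  χ (a <ᵇ L) * g (suc a)                                  ∎

-- A graph on Fin L given by an adjacency relation on ℕ (as the Dynkin
-- diagrams are), with basis vectors e a (zero when a ≥ L).
module Diagram (L : ℕ) (adj : ℕ → ℕ → Bool) where
  open Chebyshev (finSum L) (λ i j → adj (toℕ i) (toℕ j)) public

  e : ℕ → Vect (Fin L)
  e a v = χ (toℕ v ≡ᵇ a)

  act-e : ∀ a → a ℕ.< L → act (e a) ≐ (λ v → χ (adj (toℕ v) a))
  act-e a a<L v = begin
    ΣF L (λ w → χ (adj (toℕ v) (toℕ w)) * χ (toℕ w ≡ᵇ a)) ≡⟨ ΣF-δℕ L (λ j → χ (adj (toℕ v) j)) a ⟩
    χ (a <ᵇ L) * χ (adj (toℕ v) a)                       ≡⟨ cong (λ b → χ b * χ (adj (toℕ v) a)) (<ᵇ-true a<L) ⟩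
    + 1 * χ (adj (toℕ v) a)                              ≡⟨ ℤₚ.*-identityˡ _ ⟩
    χ (adj (toℕ v) a)                                    ∎

  e-beyond : ∀ a → L ℕ.≤ a → e a ≐ 𝟘
  e-beyond a L≤a v = cong χ (≡ᵇ-≢ (λ v≡a → ℕₚ.<-irrefl v≡a (ℕₚ.<-≤-trans (Finₚ.toℕ<n v) L≤a)))

  e-semipositive : ∀ a → a ℕ.< L → Semipositive (e a)
  e-semipositive a a<L =
    (λ w → χ-nonneg _) , Fin.fromℕ< a<L ,
    subst (λ b → + 0 ℤ.< χ b) (sym (trans (cong (_≡ᵇ a) (Finₚ.toℕ-fromℕ< a<L)) (≡ᵇ-refl a))) (+<+ (s≤s z≤n))

  e-nonneg : ∀ a v → + 0 ℤ.≤ e a v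
  e-nonneg a v = χ-nonneg _

  𝟏-basis : 𝟏 ≐ Σ< L e
  𝟏-basis v = sym (trans (upTo L) (cong χ (<ᵇ-true (Finₚ.toℕ<n v))))
    where upTo : ∀ M → Σ< M e v ≡ χ (toℕ v <ᵇ M)
          upTo zero = refl
          upTo (suc M) = trans (cong (_+ e M v) (upTo M)) (Σ-δ-upTo (toℕ v) M)

  path-start : ∀ P → P ℕ.< L → (∀ k → χ (adj k 0) ≡ χ (k ≡ᵇ 1)) →
    (∀ c → c ℕ.< P → ∀ k → χ (adj k (suc c)) ≡ χ (k ≡ᵇ c) + χ (k ≡ᵇ suc (suc c))) →
    ∀ N → N ℕ.≤ suc P → U N (e 0) ≐ e N
  path-start P P<L col₀ col = U-unique e P (λ _ → refl) first step
    where
      first : e 1 ≐ act (e 0)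
      first v = sym (trans (act-e 0 (ℕₚ.≤-<-trans z≤n P<L) v) (col₀ (toℕ v)))
      step : ∀ j → j ℕ.< P → e (suc (suc j)) ≐ (λ v → act (e (suc j)) v - e j v)
      step j j<P v = begin
        e (suc (suc j)) v
          ≡⟨ sym (cancel (e j v) (e (suc (suc j)) v)) ⟩
        e j v + e (suc (suc j)) v - e j v
          ≡⟨ cong (_- e j v) (sym (trans (act-e (suc j) (ℕₚ.≤-<-trans j<P P<L) v) (col j j<P (toℕ v)))) ⟩
        act (e (suc j)) v - e j v ∎
        where cancel : ∀ a b → a + b - a ≡ b
              cancel = solve-∀

  record CoxeterFacts (h : ℕ) : Set where
    field
      h-1          : ℕ
      suc-h-1      : suc h-1 ≡ h
      vanishes     : U h-1 𝟏 ≐ 𝟘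
      semipositive : ∀ N → N ℕ.< h-1 → ∃ λ w → Semipositive (U N w)

  palindromic-facts : ∀ {x} k h → suc (suc (suc k ℕ.+ suc k)) ≡ h →
    U (suc (suc k)) x ≐ U k x → (∀ N → N ℕ.≤ suc k → Semipositive (U N x)) →
    U (suc (suc k ℕ.+ suc k)) 𝟏 ≐ 𝟘 → CoxeterFacts h
  palindromic-facts {x} k h h≡ turn below-K 𝟏-vanishes = record
    { h-1 = suc (suc k ℕ.+ suc k) ; suc-h-1 = h≡ ; vanishes = 𝟏-vanishes
    ; semipositive = λ N N<h-1 → x , semipositive N (ℕₚ.≤-pred N<h-1) }
    where
      semipositive : ∀ N → N ℕ.≤ suc k ℕ.+ suc k → Semipositive (U N x)
      semipositive N N≤2K with N ℕ.≤? suc k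
      ... | yes N≤K = below-K N N≤K
      ... | no N≰K with ℕₚ.m≤n⇒∃[o]m+o≡n (ℕₚ.<⇒≤ (ℕₚ.≰⇒> N≰K))
      ...   | j , K+j≡N with ℕₚ.m≤n⇒∃[o]m+o≡n (ℕₚ.+-cancelˡ-≤ (suc k) j (suc k) (subst (ℕ._≤ suc k ℕ.+ suc k) (sym K+j≡N) N≤2K))
      ...     | c , j+c≡K =
        Semipositive-cong (λ v → trans (U-at (sym K+j≡N) x v) (sym (palindrome k turn j c (trans (ℕₚ.+-comm c j) j+c≡K) v)))
          (below-K c (ℕₚ.≤-trans (ℕₚ.m≤n+m c j) (ℕₚ.≤-reflexive j+c≡K)))

path-col₀ : ∀ k → χ (pathAdj k 0) ≡ χ (k ≡ᵇ 1)
path-col₀ zero = refl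
path-col₀ (suc zero) = refl
path-col₀ (suc (suc k)) = refl

path-col : ∀ c k → χ (pathAdj k (suc c)) ≡ χ (k ≡ᵇ c) + χ (k ≡ᵇ suc (suc c))
path-col zero zero = refl
path-col zero (suc zero) = refl
path-col zero (suc (suc zero)) = refl
path-col zero (suc (suc (suc k))) = refl
path-col (suc c) zero = refl
path-col (suc c) (suc k) = path-col c k

-- The path A_{n+1}: U_N e₀ = e_N, and e_{n+1} = 0 at N = n + 1 = h - 1.
module PathDiagram (n : ℕ) where
  open Diagram (suc n) pathAdj

  U-e₀ : ∀ N → N ℕ.≤ suc n → U N (e 0) ≐ e N
  U-e₀ = path-start n ℕₚ.≤-refl path-col₀ (λ c _ → path-col c)

  facts : CoxeterFacts (coxeterNumber (A n))
  facts = record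
    { h-1 = suc n
    ; suc-h-1 = sym (ℕₚ.+-comm (suc n) 1)
    ; vanishes = cyclic-vanishing (suc n) (suc n) 𝟏-orbit
                   (λ v → trans (U-e₀ (suc n) ℕₚ.≤-refl v) (e-beyond (suc n) ℕₚ.≤-refl v))
    ; semipositive = λ N N<n+1 → e 0 , Semipositive-cong (U-e₀ N (ℕₚ.<⇒≤ N<n+1)) (e-semipositive N N<n+1)
    }
    where
      𝟏-orbit : 𝟏 ≐ Σ< (suc n) (λ a → U a (e 0))
      𝟏-orbit v = trans (𝟏-basis v) (Σ<-cong (suc n) (λ a a≤n w → sym (U-e₀ a (ℕₚ.<⇒≤ a≤n) w)) v)

path-neighbour : ∀ k j → pathAdj k j ≡ true → k ℕ.≤ suc j
path-neighbour k j adjacent with suc k ≡ᵇ j in below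
... | true = ℕₚ.≤-trans (ℕₚ.n≤1+n k) (ℕₚ.≤-trans (ℕₚ.≤-reflexive (ℕₚ.≡ᵇ⇒≡ (suc k) j (subst T (sym below) tt))) (ℕₚ.n≤1+n j))
... | false = ℕₚ.≤-reflexive (sym (ℕₚ.≡ᵇ⇒≡ (suc j) k (subst T (sym adjacent) tt)))

path-guard : ∀ {t} k j → suc j ℕ.< t → ((k <ᵇ t) ∧ pathAdj k j) ≡ pathAdj k j
path-guard k j j+1<t with pathAdj k j in adjacent
... | false = ∧-zeroʳ _
... | true rewrite <ᵇ-true (ℕₚ.≤-<-trans (path-neighbour k j adjacent) j+1<t) = refl

path-end : ∀ k m → ((k <ᵇ suc (suc m)) ∧ pathAdj k (suc m)) ≡ (k ≡ᵇ m)
path-end zero zero = refl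
path-end zero (suc m) = refl
path-end (suc zero) zero = refl
path-end (suc (suc zero)) zero = refl
path-end (suc (suc (suc k))) zero = refl
path-end (suc k) (suc m) = path-end k m

branch-col : ∀ {t b j} k → j ℕ.< t → j ≢ b → branchAdj (suc t) b k j ≡ ((k <ᵇ t) ∧ pathAdj k j)
branch-col {t} {b} {j} k j<t j≢b
  rewrite <ᵇ-true j<t | ≡ᵇ-≢ j≢b | ≡ᵇ-≢ (ℕₚ.<⇒≢ j<t) | ∧-zeroʳ (k ≡ᵇ t) = ∨-identityʳ _

branch-vertex : ∀ {t b} k → b ℕ.< t → branchAdj (suc t) b k b ≡ ((k <ᵇ t) ∧ pathAdj k b) ∨ (k ≡ᵇ t)
branch-vertex {t} {b} k b<t
  rewrite <ᵇ-true b<t | ≡ᵇ-refl b | ≡ᵇ-≢ (ℕₚ.<⇒≢ b<t) | ∧-identityʳ (k ≡ᵇ t) = cong (((k <ᵇ t) ∧ pathAdj k b) ∨_) (∨-identityʳ (k ≡ᵇ t))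

extra-col : ∀ {t b} k → b ℕ.< t → branchAdj (suc t) b k t ≡ (k ≡ᵇ b)
extra-col {t} {b} k b<t
  rewrite <ᵇ-irrefl t | ≡ᵇ-≢ (ℕₚ.>⇒≢ b<t) | ≡ᵇ-refl t | ∧-zeroʳ (k <ᵇ t) | ∧-zeroʳ (k ≡ᵇ t) = refl

branch-col-sum : ∀ k m → χ (pathAdj k (suc m) ∨ (k ≡ᵇ suc (suc (suc m)))) ≡
  χ (k ≡ᵇ m) + χ (k ≡ᵇ suc (suc m)) + χ (k ≡ᵇ suc (suc (suc m)))
branch-col-sum zero zero = refl
branch-col-sum zero (suc m) = refl
branch-col-sum (suc zero) zero = refl
branch-col-sum (suc (suc zero)) zero = refl
branch-col-sum (suc (suc (suc zero))) zero = refl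
branch-col-sum (suc (suc (suc (suc k)))) zero = refl
branch-col-sum (suc k) (suc m) = branch-col-sum k m

-- D_{n+4}: the path 0 - ⋯ - (n+2) with the extra vertex n+3 joined to n+1.
-- With K = n + 2:  U_N e₀ = e_N for N ≤ n + 1,  U_K e₀ = e_K + e_{K+1}  and
-- U_{K+1} e₀ = e_{n+1}, so the sequence turns back at K; h = 2K + 2.
module BranchedDiagram (n : ℕ) where
  K : ℕ
  K = suc (suc n)

  adj : ℕ → ℕ → Bool
  adj = branchAdj (suc (suc K)) (suc n)

  open Diagram (suc (suc K)) adj

  private
    n+1<t : suc n ℕ.< suc K
    n+1<t = ℕₚ.m<n⇒m<1+n (ℕₚ.n<1+n (suc n))
    K<L : K ℕ.< suc (suc K)
    K<L = ℕₚ.m<n⇒m<1+n (ℕₚ.n<1+n K)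
    n+1<L : suc n ℕ.< suc (suc K)
    n+1<L = ℕₚ.<-trans (ℕₚ.n<1+n (suc n)) K<L

  col₀ : ∀ k → χ (adj k 0) ≡ χ (k ≡ᵇ 1)
  col₀ k = trans (cong χ (trans (branch-col {t = suc K} {b = suc n} k (s≤s z≤n) (λ ()))
                                (path-guard {t = suc K} k 0 (s≤s (s≤s z≤n)))))
                 (path-col₀ k)

  col : ∀ c → c ℕ.< n → ∀ k → χ (adj k (suc c)) ≡ χ (k ≡ᵇ c) + χ (k ≡ᵇ suc (suc c))
  col c c<n k = trans (cong χ (trans (branch-col {t = suc K} {b = suc n} k c+1<t c+1≢n+1)
                                     (path-guard {t = suc K} k (suc c) (s≤s (s≤s (ℕₚ.m<n⇒m<1+n c<n))))))
                      (path-col c k)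
    where c+1<t : suc c ℕ.< suc K
          c+1<t = s≤s (ℕₚ.m<n⇒m<1+n (ℕₚ.m<n⇒m<1+n c<n))
          c+1≢n+1 : suc c ≢ suc n
          c+1≢n+1 = λ c+1≡n+1 → ℕₚ.<-irrefl (ℕₚ.suc-injective c+1≡n+1) c<n

  col-branch : ∀ k → χ (adj k (suc n)) ≡ χ (k ≡ᵇ n) + χ (k ≡ᵇ K) + χ (k ≡ᵇ suc K)
  col-branch k = trans (cong χ (trans (branch-vertex {t = suc K} {b = suc n} k n+1<t)
                                      (cong (_∨ (k ≡ᵇ suc K)) (path-guard {t = suc K} k (suc n) (ℕₚ.n<1+n K)))))
                       (branch-col-sum k n)

  col-leaf : ∀ k → χ (adj k K) ≡ χ (k ≡ᵇ suc n)
  col-leaf k = cong χ (trans (branch-col {t = suc K} {b = suc n} k (ℕₚ.n<1+n K) (ℕₚ.>⇒≢ (ℕₚ.n<1+n (suc n))))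
                             (path-end k (suc n)))

  col-extra : ∀ k → χ (adj k (suc K)) ≡ χ (k ≡ᵇ suc n)
  col-extra k = cong χ (extra-col {t = suc K} {b = suc n} k n+1<t)

  U-e₀ : ∀ N → N ℕ.≤ suc n → U N (e 0) ≐ e N
  U-e₀ = path-start n (ℕₚ.<-trans (ℕₚ.n<1+n n) n+1<L) col₀ col

  at-K : U K (e 0) ≐ (λ v → e K v + e (suc K) v)
  at-K v = begin
    act (U (suc n) (e 0)) v - U n (e 0) v
      ≡⟨ cong₂ _-_ (act-cong (U-e₀ (suc n) ℕₚ.≤-refl) v) (U-e₀ n (ℕₚ.n≤1+n n) v) ⟩
    act (e (suc n)) v - e n v
      ≡⟨ cong (_- e n v) (trans (act-e (suc n) n+1<L v) (col-branch (toℕ v))) ⟩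
    e n v + e K v + e (suc K) v - e n v
      ≡⟨ cancel (e n v) (e K v) (e (suc K) v) ⟩
    e K v + e (suc K) v ∎
    where cancel : ∀ a b c → a + b + c - a ≡ b + c
          cancel = solve-∀

  turn : U (suc K) (e 0) ≐ U (suc n) (e 0)
  turn v = begin
    act (U K (e 0)) v - U (suc n) (e 0) v
      ≡⟨ cong₂ _-_ (trans (act-cong at-K v) (U-+ 1 (e K) (e (suc K)) v)) (U-e₀ (suc n) ℕₚ.≤-refl v) ⟩
    act (e K) v + act (e (suc K)) v - e (suc n) v
      ≡⟨ cong (_- e (suc n) v) (cong₂ _+_ (trans (act-e K K<L v) (col-leaf (toℕ v)))
                                          (trans (act-e (suc K) ℕₚ.≤-refl v) (col-extra (toℕ v)))) ⟩
    e (suc n) v + e (suc n) v - e (suc n) v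
      ≡⟨ cancel (e (suc n) v) ⟩
    e (suc n) v
      ≡⟨ sym (U-e₀ (suc n) ℕₚ.≤-refl v) ⟩
    U (suc n) (e 0) v ∎
    where cancel : ∀ a → a + a - a ≡ a
          cancel = solve-∀

  up-to-K : ∀ N → N ℕ.≤ K → Semipositive (U N (e 0))
  up-to-K N N≤K with N ℕ.≤? suc n
  ... | yes N≤n+1 = Semipositive-cong (U-e₀ N N≤n+1) (e-semipositive N (ℕₚ.≤-<-trans N≤n+1 n+1<L))
  ... | no N≰n+1 rewrite ℕₚ.≤-antisym N≤K (ℕₚ.≰⇒> N≰n+1) =
    Semipositive-cong at-K (Semipositive-+ (e-semipositive K K<L) (e-nonneg (suc K)))

  𝟏-orbit : 𝟏 ≐ Σ< (suc K) (λ a → U a (e 0))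
  𝟏-orbit v = begin
    + 1                                            ≡⟨ 𝟏-basis v ⟩
    Σ< K e v + e K v + e (suc K) v                 ≡⟨ ℤₚ.+-assoc (Σ< K e v) (e K v) (e (suc K) v) ⟩
    Σ< K e v + (e K v + e (suc K) v)               ≡⟨ cong₂ _+_ (Σ<-cong K (λ a a<K w → sym (U-e₀ a (ℕₚ.≤-pred a<K) w)) v) (sym (at-K v)) ⟩
    Σ< K (λ a → U a (e 0)) v + U K (e 0) v         ∎

  facts : CoxeterFacts (coxeterNumber (D n))
  facts = palindromic-facts (suc n) (coxeterNumber (D n)) (cong (ℕ._∸ 2) (sym (double n))) turn up-to-K
            (cyclic-vanishing (suc K) (suc (K ℕ.+ K)) 𝟏-orbit (palindrome-vanishes (suc n) turn))
    where double : ∀ n → 2 ℕ.* (n ℕ.+ 4) ≡ suc (suc (suc (suc (suc (suc n) ℕ.+ suc (suc n)))))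
          double = ℕ-solve-∀

-- Entry (j, i) of a table of natural numbers, 0 outside the table.
entry : List (List ℕ) → ℕ → ℕ → ℕ
entry [] j i = 0
entry (r ∷ rs) (suc j) i = entry rs j i
entry (r ∷ rs) zero i = at r i
  where at : List ℕ → ℕ → ℕ
        at [] i = 0
        at (x ∷ xs) zero = x
        at (x ∷ xs) (suc i) = at xs i

-- The exceptional types are settled by computation: the rows of a table are
-- checked to be U_0 𝟏, …, U_{K+1} 𝟏, positive somewhere up to K, and to turn
-- back at K (row K + 1 = row K − 1).
module Certified (L : ℕ) (adj : ℕ → ℕ → Bool) (table : List (List ℕ)) where
  open Diagram L adj

  row : ℕ → Vect (Fin L)
  row j v = + entry table j (toℕ v)

  Valid : ℕ → Set
  Valid k =
    (row 0 ≐ 𝟏) × (row 1 ≐ act 𝟏) ×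
    (∀ {j} → j ℕ.< suc k → row (suc (suc j)) ≐ (λ v → act (row (suc j)) v - row j v)) ×
    (row (suc (suc k)) ≐ row k) ×
    (∀ {j} → j ℕ.< suc (suc k) → ∃ λ v → + 0 ℤ.< row j v)

  valid? : ∀ k → Dec (Valid k)
  valid? k =
    (row 0 ≐? 𝟏) ×-dec (row 1 ≐? act 𝟏) ×-dec
    ℕₚ.allUpTo? (λ j → row (suc (suc j)) ≐? (λ v → act (row (suc j)) v - row j v)) (suc k) ×-dec
    (row (suc (suc k)) ≐? row k) ×-dec
    ℕₚ.allUpTo? (λ j → Finₚ.any? (λ v → + 0 ℤₚ.<? row j v)) (suc (suc k))
    where _≐?_ : ∀ x y → Dec (x ≐ y)
          x ≐? y = Finₚ.all? (λ v → x v ℤₚ.≟ y v)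

  certified-facts : ∀ k h → suc (suc (suc k ℕ.+ suc k)) ≡ h → Valid k → CoxeterFacts h
  certified-facts k h h≡ (row₀ , row₁ , recurrence , row-turn , positive) =
    palindromic-facts k h h≡ turn up-to-K (palindrome-vanishes k turn)
    where
      U≐row : ∀ j → j ℕ.≤ suc (suc k) → U j 𝟏 ≐ row j
      U≐row = U-unique row (suc k) row₀ row₁ (λ _ → recurrence)
      turn : U (suc (suc k)) 𝟏 ≐ U k 𝟏
      turn v = trans (U≐row (suc (suc k)) ℕₚ.≤-refl v)
                     (trans (row-turn v) (sym (U≐row k (ℕₚ.≤-trans (ℕₚ.n≤1+n k) (ℕₚ.n≤1+n (suc k))) v)))
      up-to-K : ∀ N → N ℕ.≤ suc k → Semipositive (U N 𝟏)
      up-to-K N N≤K = Semipositive-cong (U≐row N (ℕₚ.m≤n⇒m≤1+n N≤K)) ((λ v → +≤+ z≤n) , positive (s≤s N≤K))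

-- Row N is the vector U_N 𝟏 on E₆, E₇, E₈ (vertices ordered as in dynkinAdj'),
-- for N ≤ K + 1 where h = 2K + 2.
E₆-table : List (List ℕ)
E₆-table =
  (1 ∷ 1 ∷ 1 ∷ 1 ∷ 1 ∷ 1 ∷ []) ∷
  (1 ∷ 2 ∷ 3 ∷ 2 ∷ 1 ∷ 1 ∷ []) ∷
  (1 ∷ 3 ∷ 4 ∷ 3 ∷ 1 ∷ 2 ∷ []) ∷
  (2 ∷ 3 ∷ 5 ∷ 3 ∷ 2 ∷ 3 ∷ []) ∷
  (2 ∷ 4 ∷ 5 ∷ 4 ∷ 2 ∷ 3 ∷ []) ∷
  (2 ∷ 4 ∷ 6 ∷ 4 ∷ 2 ∷ 2 ∷ []) ∷
  (2 ∷ 4 ∷ 5 ∷ 4 ∷ 2 ∷ 3 ∷ []) ∷ []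

E₇-table : List (List ℕ)
E₇-table =
  (1 ∷ 1 ∷ 1 ∷ 1 ∷ 1 ∷ 1 ∷ 1 ∷ []) ∷
  (1 ∷ 2 ∷ 3 ∷ 2 ∷ 2 ∷ 1 ∷ 1 ∷ []) ∷
  (1 ∷ 3 ∷ 4 ∷ 4 ∷ 2 ∷ 1 ∷ 2 ∷ []) ∷
  (2 ∷ 3 ∷ 6 ∷ 4 ∷ 3 ∷ 1 ∷ 3 ∷ []) ∷
  (2 ∷ 5 ∷ 6 ∷ 5 ∷ 3 ∷ 2 ∷ 4 ∷ []) ∷
  (3 ∷ 5 ∷ 8 ∷ 5 ∷ 4 ∷ 2 ∷ 3 ∷ []) ∷
  (3 ∷ 6 ∷ 7 ∷ 7 ∷ 4 ∷ 2 ∷ 4 ∷ []) ∷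
  (3 ∷ 5 ∷ 9 ∷ 6 ∷ 5 ∷ 2 ∷ 4 ∷ []) ∷
  (2 ∷ 6 ∷ 8 ∷ 7 ∷ 4 ∷ 3 ∷ 5 ∷ []) ∷
  (3 ∷ 5 ∷ 9 ∷ 6 ∷ 5 ∷ 2 ∷ 4 ∷ []) ∷ []

E₈-table : List (List ℕ)
E₈-table =
  (1 ∷ 1 ∷ 1 ∷ 1 ∷ 1 ∷ 1 ∷ 1 ∷ 1 ∷ []) ∷
  (1 ∷ 2 ∷ 3 ∷ 2 ∷ 2 ∷ 2 ∷ 1 ∷ 1 ∷ []) ∷
  (1 ∷ 3 ∷ 4 ∷ 4 ∷ 3 ∷ 2 ∷ 1 ∷ 2 ∷ []) ∷
  (2 ∷ 3 ∷ 6 ∷ 5 ∷ 4 ∷ 2 ∷ 1 ∷ 3 ∷ []) ∷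
  (2 ∷ 5 ∷ 7 ∷ 6 ∷ 4 ∷ 3 ∷ 1 ∷ 4 ∷ []) ∷
  (3 ∷ 6 ∷ 9 ∷ 6 ∷ 5 ∷ 3 ∷ 2 ∷ 4 ∷ []) ∷
  (4 ∷ 7 ∷ 9 ∷ 8 ∷ 5 ∷ 4 ∷ 2 ∷ 5 ∷ []) ∷
  (4 ∷ 7 ∷ 11 ∷ 8 ∷ 7 ∷ 4 ∷ 2 ∷ 5 ∷ []) ∷
  (3 ∷ 8 ∷ 11 ∷ 10 ∷ 7 ∷ 5 ∷ 2 ∷ 6 ∷ []) ∷
  (4 ∷ 7 ∷ 13 ∷ 10 ∷ 8 ∷ 5 ∷ 3 ∷ 6 ∷ []) ∷
  (4 ∷ 9 ∷ 12 ∷ 11 ∷ 8 ∷ 6 ∷ 3 ∷ 7 ∷ []) ∷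
  (5 ∷ 9 ∷ 14 ∷ 10 ∷ 9 ∷ 6 ∷ 3 ∷ 6 ∷ []) ∷
  (5 ∷ 10 ∷ 13 ∷ 12 ∷ 8 ∷ 6 ∷ 3 ∷ 7 ∷ []) ∷
  (5 ∷ 9 ∷ 15 ∷ 11 ∷ 9 ∷ 5 ∷ 3 ∷ 7 ∷ []) ∷
  (4 ∷ 10 ∷ 14 ∷ 12 ∷ 8 ∷ 6 ∷ 2 ∷ 8 ∷ []) ∷
  (5 ∷ 9 ∷ 15 ∷ 11 ∷ 9 ∷ 5 ∷ 3 ∷ 7 ∷ []) ∷ []

E₆-facts : Diagram.CoxeterFacts (rank E6) (dynkinAdj' E6) (coxeterNumber E6)
E₆-facts = certified-facts 4 12 refl (toWitness {a? = valid? 4} tt)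
  where open Certified (rank E6) (dynkinAdj' E6) E₆-table

E₇-facts : Diagram.CoxeterFacts (rank E7) (dynkinAdj' E7) (coxeterNumber E7)
E₇-facts = certified-facts 7 18 refl (toWitness {a? = valid? 7} tt)
  where open Certified (rank E7) (dynkinAdj' E7) E₇-table

E₈-facts : Diagram.CoxeterFacts (rank E8) (dynkinAdj' E8) (coxeterNumber E8)
E₈-facts = certified-facts 13 30 refl (toWitness {a? = valid? 13} tt)
  where open Certified (rank E8) (dynkinAdj' E8) E₈-table

open Diagram.CoxeterFacts

coxeter-facts : ∀ T → Diagram.CoxeterFacts (rank T) (dynkinAdj' T) (coxeterNumber T)
coxeter-facts (A n) = PathDiagram.facts n
coxeter-facts (D n) =
  subst₂ (λ L b → Diagram.CoxeterFacts L (branchAdj L b) (coxeterNumber (D n)))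
         (sym (ℕₚ.+-comm n 4)) (sym (ℕₚ.+-comm n 1)) (BranchedDiagram.facts n)
coxeter-facts E6 = E₆-facts
coxeter-facts E7 = E₇-facts
coxeter-facts E8 = E₈-facts

ι-Invariant : ∀ {k m} → Graph (SV k m) → Set
ι-Invariant G = ∀ u v → G (ι u) (ι v) ≡ G u v

Even : ∀ {k m} → Vect (SV k m) → Set
Even x = ∀ v → x (ι v) ≡ x v

even-act : ∀ {k m} (H : Graph (SV k m)) → ι-Invariant H → ∀ {x} → Even x →
  Even (Adjacency.act (svSum k m) H x)
even-act {k} {m} H Hι {x} x-even v = begin
  sum (svSum k m) (λ w → χ (H (ι v) w) * x w)          ≡⟨ sym (sum-ι (λ w → χ (H (ι v) w) * x w)) ⟩
  sum (svSum k m) (λ w → χ (H (ι v) (ι w)) * x (ι w))  ≡⟨ sum-cong (svSum k m) (λ w → cong₂ (λ a b → χ a * b) (Hι v w) (x-even w)) ⟩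
  sum (svSum k m) (λ w → χ (H v w) * x w)              ∎

dual-rules-sym : ∀ {k m} {G : Graph (SV k m)} {X} {G* : Graph (SV m k)} {X*} →
  DualRules G X G* X* → DualRules G* X* G X
dual-rules-sym (r₁ , r₂ , r₃ , r₄ , r₅) =
  (λ i j → sym (r₅ i j)) , (λ i j → sym (r₄ i j)) , (λ a j → sym (r₃ j a)) ,
  (λ a b → sym (r₂ a b)) , (λ a b → sym (r₁ a b))

dual-pos-fix : ∀ {k m} {G : Graph (SV k m)} {X} {G* : Graph (SV m k)} {X*} →
  DualRules G X G* X* → ι-Invariant G → ι-Invariant G* →
  ∀ a j → G (pos a) (fix j) ≡ G* (pos j) (fix a)
dual-pos-fix {G = G} {G* = G*} (_ , _ , r₃ , _ , _) Gι G*ι a j = begin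
  G (pos a) (fix j)                        ≡⟨ sym (∧-idem _) ⟩
  G (pos a) (fix j) ∧ G (pos a) (fix j)    ≡⟨ cong (G (pos a) (fix j) ∧_) (sym (Gι (pos a) (fix j))) ⟩
  G (pos a) (fix j) ∧ G (neg a) (fix j)    ≡⟨ r₃ a j ⟩
  G* (pos j) (fix a) ∧ G* (neg j) (fix a)  ≡⟨ cong (G* (pos j) (fix a) ∧_) (G*ι (pos j) (fix a)) ⟩
  G* (pos j) (fix a) ∧ G* (pos j) (fix a)  ≡⟨ ∧-idem _ ⟩
  G* (pos j) (fix a)                       ∎

χ-split : ∀ c x → χ (c ∧ not x) + χ (c ∧ x) ≡ χ c
χ-split true true = refl
χ-split true false = refl
χ-split false x = refl

-- The edges from v_a^+ to v_b^+ and to v_b^- merge into the edge u_a — u_b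
-- of G* (X* records which of the two is present).
dual-merge : ∀ {k m} {G : Graph (SV k m)} {X} {G* : Graph (SV m k)} {X*} →
  DualRules G X G* X* → ι-Invariant G →
  ∀ a b → χ (G (pos a) (pos b)) + χ (G (pos a) (neg b)) ≡ χ (G* (fix a) (fix b))
dual-merge {G = G} {G* = G*} {X* = X*} (_ , _ , _ , r₄ , r₅) Gι a b =
  trans (cong₂ (λ p q → χ p + χ q) same opposite) (χ-split (G* (fix a) (fix b)) (X* a b))
  where
    same : G (pos a) (pos b) ≡ G* (fix a) (fix b) ∧ not (X* a b)
    same = trans (sym (trans (cong (G (pos a) (pos b) ∧_) (Gι (pos a) (pos b))) (∧-idem _))) (r₄ a b)
    opposite : G (pos a) (neg b) ≡ G* (fix a) (fix b) ∧ X* a b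
    opposite = trans (sym (trans (cong (G (pos a) (neg b) ∧_) (Gι (pos a) (neg b))) (∧-idem _))) (r₅ a b)

module Folding {k m} {G : Graph (SV k m)} {X} {G* : Graph (SV m k)} {X*}
  (dual : DualRules G X G* X*) (Gι : ι-Invariant G) (G*ι : ι-Invariant G*)
  (G-sym : ∀ u v → G u v ≡ G v u) (G*-sym : ∀ u v → G* u v ≡ G* v u) where

  module A = Adjacency (svSum k m) G
  module A* = Adjacency (svSum m k) G*

  fold : Vect (SV k m) → Vect (SV m k)
  fold x (fix a) = x (pos a) + x (neg a)
  fold x (pos j) = x (fix j)
  fold x (neg j) = x (fix j)

  fold-even : ∀ x → Even (fold x)
  fold-even x (pos j) = refl
  fold-even x (neg j) = refl
  fold-even x (fix a) = refl

  fold-cong : ∀ {x y} → x ≐ y → fold x ≐ fold y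
  fold-cong x≐y (fix a) = cong₂ _+_ (x≐y (pos a)) (x≐y (neg a))
  fold-cong x≐y (pos j) = x≐y (fix j)
  fold-cong x≐y (neg j) = x≐y (fix j)

  fold-𝟘 : fold 𝟘 ≐ 𝟘
  fold-𝟘 (fix a) = refl
  fold-𝟘 (pos j) = refl
  fold-𝟘 (neg j) = refl

  fold-𝟏-positive : ∀ v → + 0 ℤ.< fold 𝟏 v
  fold-𝟏-positive (fix a) = +<+ (s≤s z≤n)
  fold-𝟏-positive (pos j) = +<+ (s≤s z≤n)
  fold-𝟏-positive (neg j) = +<+ (s≤s z≤n)

  fold-sub : ∀ x y → fold (λ v → x v - y v) ≐ (λ w → fold x w - fold y w)
  fold-sub x y (fix a) = regroup (x (pos a)) (y (pos a)) (x (neg a)) (y (neg a))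
    where regroup : ∀ a b c d → (a - b) + (c - d) ≡ (a + c) - (b + d)
          regroup = solve-∀
  fold-sub x y (pos j) = refl
  fold-sub x y (neg j) = refl

  -- The row of A_{G*} at u_a: the fixed neighbours u_j^± of u_a are the
  -- fixed neighbours of v_a^+, and u_b is weighted by the merged edges.
  private
    act-at-pos-pair : ∀ {x} → Even x → ∀ a → fold (A.act x) (fix a) ≡ A*.act (fold x) (fix a)
    act-at-pos-pair {x} x-even a = begin
      A.act x (pos a) + A.act x (neg a)   ≡⟨ cong (_+_ (A.act x (pos a))) (even-act G Gι x-even (pos a)) ⟩
      P + N + F + (P + N + F)            ≡⟨ regroup P N F ⟩
      F + F + (P + N + (P + N))          ≡⟨ cong₂ _+_ (cong₂ _+_ (sym to-pos) (sym to-neg)) (sym merged) ⟩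
      A*.act (fold x) (fix a)            ∎
      where
        P N F : ℤ
        P = ΣF k (λ b → χ (G (pos a) (pos b)) * x (pos b))
        N = ΣF k (λ b → χ (G (pos a) (neg b)) * x (neg b))
        F = ΣF m (λ j → χ (G (pos a) (fix j)) * x (fix j))
        regroup : ∀ p n f → p + n + f + (p + n + f) ≡ f + f + (p + n + (p + n))
        regroup = solve-∀
        to-pos : ΣF m (λ j → χ (G* (fix a) (pos j)) * x (fix j)) ≡ F
        to-pos = sum-cong (finSum m) (λ j → cong (λ g → χ g * x (fix j))
                   (trans (G*-sym (fix a) (pos j)) (sym (dual-pos-fix {G = G} {G* = G*} dual Gι G*ι a j))))
        to-neg : ΣF m (λ j → χ (G* (fix a) (neg j)) * x (fix j)) ≡ F
        to-neg = trans (sum-cong (finSum m) (λ j → cong (λ g → χ g * x (fix j)) (G*ι (fix a) (pos j)))) to-pos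
        twice : ∀ p q s t → t ≡ s → (p + q) * (s + t) ≡ (p * s + q * t) + (p * s + q * t)
        twice p q s .s refl = expand p q s
          where expand : ∀ p q s → (p + q) * (s + s) ≡ (p * s + q * s) + (p * s + q * s)
                expand = solve-∀
        merged : ΣF k (λ b → χ (G* (fix a) (fix b)) * (x (pos b) + x (neg b))) ≡ P + N + (P + N)
        merged = begin
          ΣF k (λ b → χ (G* (fix a) (fix b)) * (x (pos b) + x (neg b)))
            ≡⟨ sum-cong (finSum k) (λ b → trans (cong (_* (x (pos b) + x (neg b))) (sym (dual-merge {G = G} {G* = G*} dual Gι a b)))
                                               (twice (χ (G (pos a) (pos b))) (χ (G (pos a) (neg b))) (x (pos b)) (x (neg b)) (x-even (pos b)))) ⟩
          ΣF k (λ b → row b + row b)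
            ≡⟨ sum-+ (finSum k) row row ⟩
          ΣF k row + ΣF k row
            ≡⟨ cong₂ _+_ (sum-+ (finSum k) _ _) (sum-+ (finSum k) _ _) ⟩
          P + N + (P + N) ∎
          where row : Fin k → ℤ
                row b = χ (G (pos a) (pos b)) * x (pos b) + χ (G (pos a) (neg b)) * x (neg b)

    act-at-fixed : ∀ x j → fold (A.act x) (pos j) ≡ A*.act (fold x) (pos j)
    act-at-fixed x j = begin
      P + N + F                 ≡⟨ cong₂ _+_ (sym from-pair) (sym merged) ⟩
      R₃ + (R₁ + R₂)            ≡⟨ ℤₚ.+-comm R₃ (R₁ + R₂) ⟩
      R₁ + R₂ + R₃              ∎
      where
        P N F R₁ R₂ R₃ : ℤ
        P = ΣF k (λ b → χ (G (fix j) (pos b)) * x (pos b))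
        N = ΣF k (λ b → χ (G (fix j) (neg b)) * x (neg b))
        F = ΣF m (λ i → χ (G (fix j) (fix i)) * x (fix i))
        R₁ = ΣF m (λ i → χ (G* (pos j) (pos i)) * x (fix i))
        R₂ = ΣF m (λ i → χ (G* (pos j) (neg i)) * x (fix i))
        R₃ = ΣF k (λ b → χ (G* (pos j) (fix b)) * (x (pos b) + x (neg b)))
        to-pos : ∀ b → G* (pos j) (fix b) ≡ G (fix j) (pos b)
        to-pos b = trans (sym (dual-pos-fix {G = G} {G* = G*} dual Gι G*ι b j)) (G-sym (pos b) (fix j))
        to-neg : ∀ b → G* (pos j) (fix b) ≡ G (fix j) (neg b)
        to-neg b = trans (to-pos b) (sym (Gι (fix j) (pos b)))
        from-pair : R₃ ≡ P + N
        from-pair = trans (sum-cong (finSum k) (λ b → trans (ℤₚ.*-distribˡ-+ (χ (G* (pos j) (fix b))) (x (pos b)) (x (neg b)))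
                      (cong₂ _+_ (cong (λ g → χ g * x (pos b)) (to-pos b)) (cong (λ g → χ g * x (neg b)) (to-neg b)))))
                          (sum-+ (finSum k) _ _)
        merged : R₁ + R₂ ≡ F
        merged = trans (sym (sum-+ (finSum m) _ _))
                   (sum-cong (finSum m) (λ i → trans (sym (ℤₚ.*-distribʳ-+ (x (fix i)) (χ (G* (pos j) (pos i))) (χ (G* (pos j) (neg i)))))
                     (cong (_* x (fix i)) (dual-merge {G = G*} {G* = G} (dual-rules-sym {G = G} {X = X} {G* = G*} {X* = X*} dual) G*ι j i))))

  fold-act : ∀ {x} → Even x → fold (A.act x) ≐ A*.act (fold x)
  fold-act x-even (fix a) = act-at-pos-pair x-even a
  fold-act {x} x-even (pos j) = act-at-fixed x j
  fold-act {x} x-even (neg j) = trans (act-at-fixed x j) (sym (even-act G* G*ι (fold-even x) (pos j)))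

  fold-U : ∀ {x} → Even x → ∀ N → fold (A.U N x) ≐ A*.U N (fold x)
  fold-U x-even N = proj₂ (intertwine x-even N)
    where open Intertwining (svSum k m) (svSum m k) G G* Even fold (even-act G Gι)
                 (λ x-even y-even v → cong₂ _-_ (x-even v) (y-even v)) fold-cong fold-sub fold-act

module CommonCoxeterNumber {k m} (G : Graph (SV k m)) (G-sym : ∀ u v → G u v ≡ G v u)
  {h} (common : IsCommonCoxeterNumber G h) where
  open Adjacency (svSum k m) G

  private
    h-1≡ : ∀ T → coxeterNumber T ≡ h → pred h ≡ h-1 (coxeter-facts T)
    h-1≡ T cox≡h = cong pred (sym (trans (suc-h-1 (coxeter-facts T)) cox≡h))

  suc-pred-h : suc (pred h) ≡ h
  suc-pred-h with proj₂ common (proj₁ common)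
  ... | T , _ , cox≡h = trans (cong suc (h-1≡ T cox≡h)) (trans (suc-h-1 (coxeter-facts T)) cox≡h)

  vanishing : U (pred h) 𝟏 ≐ 𝟘
  vanishing v = at-component (proj₂ common v)
    where
      at-component : Σ[ T ∈ DynkinType ] ComponentOfType G v T × coxeterNumber T ≡ h → U (pred h) 𝟏 v ≡ + 0
      at-component (T , C , cox≡h) = begin
        U (pred h) 𝟏 v                           ≡⟨ cong (U (pred h) 𝟏) (sym (proj₂ R.base-point)) ⟩
        U (pred h) 𝟏 (R.embedding i)             ≡⟨ R.restrict-U 𝟏 (pred h) i ⟩
        D.U (pred h) 𝟏 i                         ≡⟨ D.U-at (h-1≡ T cox≡h) 𝟏 i ⟩
        D.U (h-1 (coxeter-facts T)) 𝟏 i          ≡⟨ vanishes (coxeter-facts T) i ⟩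
        + 0                                      ∎
        where module R = Restriction (svSum k m) _≟ˢ_ sv-δ G {v} {T} C
              module D = Diagram (rank T) (dynkinAdj' T)
              i : Fin (rank T)
              i = proj₁ R.base-point

  nonvanishing : ∀ y → (∀ v → + 0 ℤ.< y v) → ∀ N → suc N ℕ.< h → ¬ (U N y ≐ 𝟘)
  nonvanishing y y>0 N N<h-1 UNy≐0 with proj₂ common (proj₁ common)
  ... | T , C , cox≡h
    with semipositive (coxeter-facts T) N (subst (N ℕ.<_) (h-1≡ T cox≡h) (ℕₚ.≤-pred (ℕₚ.≤-trans N<h-1 (ℕₚ.≤-reflexive (sym (suc-pred-h))))))
  ...   | w , w-semipositive = ℤₚ.<-irrefl (sym inner≡0) (inner-positive (rank T) (y ∘ f) (D.U N w) (y>0 ∘ f) w-semipositive)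
    where
      module R = Restriction (svSum k m) _≟ˢ_ sv-δ G {proj₁ common} {T} C
      module D = Diagram (rank T) (dynkinAdj' T)
      f : Fin (rank T) → SV k m
      f = R.embedding
      open SelfAdjoint (dynkinAdj T) (R.diagram-symmetric G-sym)
      inner≡0 : inner (y ∘ f) (D.U N w) ≡ + 0
      inner≡0 = begin
        inner (y ∘ f) (D.U N w)   ≡⟨ sym (U-self-adjoint N (y ∘ f) w) ⟩
        inner (D.U N (y ∘ f)) w   ≡⟨ sum-𝟘 (finSum (rank T)) (λ i → cong (_* w i) (trans (sym (R.restrict-U y N i)) (UNy≐0 (f i)))) ⟩
        + 0                       ∎

-- If B* is dual to B, the Coxeter number of G* is at most that of G: folding
-- carries the vanishing U_{h-1}(A_G) 𝟏 = 0 to U_{h-1}(A_{G*}) (fold 𝟏) = 0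
-- with fold 𝟏 positive, impossible if h < h*.
coxeter-≤ : ∀ {k m} {G : Graph (SV k m)} {X} {G* : Graph (SV m k)} {X*} →
  DualRules G X G* X* → ι-Invariant G → ι-Invariant G* →
  (∀ u v → G u v ≡ G v u) → (∀ u v → G* u v ≡ G* v u) →
  ∀ {h h*} → IsCommonCoxeterNumber G h → IsCommonCoxeterNumber G* h* → h* ℕ.≤ h
coxeter-≤ {G = G} {G* = G*} dual Gι G*ι G-sym G*-sym {h} {h*} common common* = ℕₚ.≮⇒≥ λ h<h* →
  B*.nonvanishing (fold 𝟏) fold-𝟏-positive (pred h) (subst (ℕ._< h*) (sym B.suc-pred-h) h<h*)
    (λ v → trans (sym (fold-U (λ _ → refl) (pred h) v)) (trans (fold-cong B.vanishing v) (fold-𝟘 v)))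
  where
    open Folding dual Gι G*ι G-sym G*-sym
    module B = CommonCoxeterNumber G G-sym common
    module B* = CommonCoxeterNumber G* G*-sym common*

same-coxeter : ∀ {k m} {G : Graph (SV k m)} {X} {G* : Graph (SV m k)} {X*} →
  DualRules G X G* X* → ι-Invariant G → ι-Invariant G* →
  (∀ u v → G u v ≡ G v u) → (∀ u v → G* u v ≡ G* v u) →
  ∀ {h h*} → IsCommonCoxeterNumber G h → IsCommonCoxeterNumber G* h* → h ≡ h*
same-coxeter {G = G} {X} {G*} {X*} dual Gι G*ι G-sym G*-sym common common* =
  ℕₚ.≤-antisym (coxeter-≤ (dual-rules-sym {G = G} {X} {G*} {X*} dual) G*ι Gι G*-sym G-sym common* common)
               (coxeter-≤ dual Gι G*ι G-sym G*-sym common common*)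

proposition9p5 : {k m : ℕ} (B : SymLabeledBigraph k m) (B* : SymLabeledBigraph m k) →
  IsDual B B* →
  IsAdmissibleADE (Γ B) (Δ B) → IsAdmissibleADE (Γ B*) (Δ B*) →
  (h h′ h* h′* : ℕ) →
  IsCommonCoxeterNumber (Γ B) h → IsCommonCoxeterNumber (Δ B) h′ →
  IsCommonCoxeterNumber (Γ B*) h* → IsCommonCoxeterNumber (Δ B*) h′* →
  (h ≡ h*) × (h′ ≡ h′*)
proposition9p5 B B* (dualΓ , dualΔ) _ _ h h′ h* h′* commonΓ commonΔ commonΓ* commonΔ* =
  same-coxeter dualΓ (ι-Γ B) (ι-Γ B*) (Γ-symmetric B) (Γ-symmetric B*) commonΓ commonΓ* ,
  same-coxeter dualΔ (ι-Δ B) (ι-Δ B*) (Δ-symmetric B) (Δ-symmetric B*) commonΔ commonΔ*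
  where
    Γ-symmetric : ∀ {k m} (B : SymLabeledBigraph k m) → ∀ u v → Γ B u v ≡ Γ B v u
    Γ-symmetric B = proj₁ (bigraph B)
    Δ-symmetric : ∀ {k m} (B : SymLabeledBigraph k m) → ∀ u v → Δ B u v ≡ Δ B v u
    Δ-symmetric B = proj₁ (proj₂ (proj₂ (bigraph B)))
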